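{- A separable metric space is pointwise regular with respect to its metric topology.
   Context: We work constructively in higher-order intuitionistic logic with Dependent Choice. For a metric space $(M,d)$ the metric topology $\mathcal{T}$ is the collection of countable unions of open balls $B(y,r)=\{z\mid d(y,z)<r\}$, $r>0$. Separable means there is a dense sequence. A space $(X,\mathcal{T})$ is (pointwise) regular if whenever $x\in U\in\mathcal{T}$ there are disjoint $S,T\in\mathcal{T}$ with $x\in S\subseteq U$ and $T\cup U = X$. -}

module Defs where

open import Data.Nat as ℕ using (ℕ; suc; _*_)
open import Data.Integer using (+_)
open import Data.Rational using (ℚ; _/_; _+_; _-_; ∣_∣; _≤_; _<_; 0ℚ)
open import Data.Maybe using (Maybe; just)
open import Data.Product using (Σ; ∃; ∃-syntax; _×_; _,_)
open import Data.Sum using (_⊎_)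
open import Data.Empty using (⊥)
open import Relation.Binary.PropositionalEquality using (_≡_)

-- Constructive (Bishop) real numbers: regular sequences of rationals.
-- Index n (starting at 0) plays the role of Bishop's index n+1, so the
-- modulus of regularity is 1/(n+1).

1/suc : ℕ → ℚ
1/suc n = + 1 / suc n

2/suc : ℕ → ℚ
2/suc n = + 2 / suc n

Seq : Set
Seq = ℕ → ℚ

IsRegular : Seq → Set
IsRegular x = ∀ m n → ∣ x m - x n ∣ ≤ 1/suc m + 1/suc n

record ℝ : Set where
  constructor mkℝ
  field
    seq : Seq
    reg : IsRegular seq
open ℝ public

-- sum: (x + y)ₙ = x₂ₙ₊₁ + y₂ₙ₊₁   (Bishop: x₂ₙ + y₂ₙ)
_+ˢ_ : Seq → Seq → Seq
(x +ˢ y) n = x (suc (2 * n)) + y (suc (2 * n))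

0ˢ : Seq
0ˢ _ = 0ℚ

_≈ˢ_ : Seq → Seq → Set
x ≈ˢ y = ∀ n → ∣ x n - y n ∣ ≤ 2/suc n

_≤ˢ_ : Seq → Seq → Set
x ≤ˢ y = ∀ n → x n ≤ y n + 2/suc n

_<ˢ_ : Seq → Seq → Set
x <ˢ y = ∃[ n ] (2/suc n < y n - x n)

_≈_ : ℝ → ℝ → Set
x ≈ y = seq x ≈ˢ seq y

_<ℝ_ : ℝ → ℝ → Set
x <ℝ y = seq x <ˢ seq y

Positive : ℝ → Set
Positive r = 0ˢ <ˢ seq r

record MetricSpace : Set₁ where
  field
    Carrier : Set
    d       : Carrier → Carrier → ℝ
    d-zero⇒≡ : ∀ x y → seq (d x y) ≈ˢ 0ˢ → x ≡ y
    ≡⇒d-zero : ∀ x → seq (d x x) ≈ˢ 0ˢ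
    d-sym    : ∀ x y → d x y ≈ d y x
    d-tri    : ∀ x y z → seq (d x z) ≤ˢ (seq (d x y) +ˢ seq (d y z))

Subset : Set → Set₁
Subset X = X → Set

module _ (M : MetricSpace) where
  open MetricSpace M

  Ball : Carrier → ℝ → Subset Carrier
  Ball y r z = d y z <ℝ r

  record PosBall : Set where
    constructor ball
    field
      centre  : Carrier
      radius  : ℝ
      pos     : Positive radius

  -- A countable
  -- family of balls is indexed by a detachable subset of ℕ, i.e. given
  -- as a sequence of optional balls (this allows the empty union).
  IsOpen : Subset Carrier → Set
  IsOpen U =
    Σ (ℕ → Maybe PosBall) λ f →
      ∀ z → (U z → ∃[ n ] Σ PosBall λ b →
                      (f n ≡ just b) × Ball (PosBall.centre b) (PosBall.radius b) z)
          × ((∃[ n ] Σ PosBall λ b →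
                      (f n ≡ just b) × Ball (PosBall.centre b) (PosBall.radius b) z) → U z)

  Separable : Set
  Separable = Σ (ℕ → Carrier) λ s →
    ∀ x (r : ℝ) → Positive r → ∃[ n ] Ball x r (s n)

  PointwiseRegular : Set₁
  PointwiseRegular =
    ∀ (x : Carrier) (U : Subset Carrier) → IsOpen U → U x →
      Σ (Subset Carrier) λ S → Σ (Subset Carrier) λ T →
        IsOpen S × IsOpen T
        × (∀ z → S z → T z → ⊥)
        × S x
        × (∀ z → S z → U z)
        × (∀ z → T z ⊎ U z)

{-# OPTIONS --safe #-}

-- Let x ∈ U. Some basic ball of U contains a rational ball B(x, ε); fix
-- a unit δ = 1/(N+1) with 8δ < ε and put S = B(x, 2δ). For each point sₙ
-- of the dense sequence decide the rational inequality 6δ ≤ d(x, sₙ)_N,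
-- where d(x, sₙ)_N is the N-th approximation of the real d(x, sₙ), and
-- let T be the union of the balls B(sₙ, 2δ) with "yes" answers.
-- Such an sₙ is at least 5δ away from x, so its ball misses S. Every z
-- has some sₙ within δ; if the answer for sₙ is "yes" then z ∈ T, and if
-- it is "no" then d(x, z) ≤ 7δ + δ < ε, so z ∈ U.

module Submission where

open import Defs
open import Data.Nat as ℕ using (ℕ; zero; suc)
import Data.Nat.Properties as ℕ
import Data.Nat.Tactic.RingSolver as ℕ
open import Data.Integer as ℤ using (+_)
import Data.Integer.Properties as ℤ
import Data.Integer.Tactic.RingSolver as ℤ
open import Data.Rational
  using (ℚ; mkℚ; 0ℚ; _/_; _+_; -_; _-_; ∣_∣; _≤_; _<_; _≤?_; toℚᵘ; fromℚᵘ; *<*)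
open import Data.Rational.Properties
open import Data.Rational.Unnormalised as ℚᵘ using (mkℚᵘ)
import Data.Rational.Unnormalised.Properties as ℚᵘ
open import Data.Maybe using (Maybe; just; nothing)
open import Data.Product using (Σ; ∃-syntax; _×_; _,_; proj₁; proj₂)
open import Data.Sum as Sum using (_⊎_; inj₁; inj₂)
open import Data.Empty using (⊥)
open import Function using (id)
open import Relation.Nullary using (Dec; yes; no; ¬_; contradiction)
open import Relation.Nullary.Decidable using (toSum)
open import Relation.Binary.PropositionalEquality
open import Algebra.Bundles using (CommutativeMonoid)
open import Algebra.Properties.CommutativeSemigroup
  (CommutativeMonoid.commutativeSemigroup +-0-commutativeMonoid)
  using (interchange; x∙yz≈xz∙y)
open import Data.Rational.Solver using (module +-*-Solver)

p+[q-p]≡q : ∀ p q → p + (q - p) ≡ q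
p+[q-p]≡q = solve 2 (λ p q → p :+ (q :- p) := q) refl
  where open +-*-Solver

p+q-q≡p : ∀ p q → p + q - q ≡ p
p+q-q≡p = solve 2 (λ p q → p :+ q :- q := p) refl
  where open +-*-Solver

p-q+q≡p : ∀ p q → p - q + q ≡ p
p-q+q≡p = solve 2 (λ p q → p :- q :+ q := p) refl
  where open +-*-Solver

p≤∣p∣ : ∀ p → p ≤ ∣ p ∣
p≤∣p∣ (mkℚ (+ _) _ _)       = ≤-refl
p≤∣p∣ p@(mkℚ ℤ.-[1+ _ ] _ _) = ≤-trans (nonPositive⁻¹ p) (0≤∣p∣ p)

≤⇒≯ : ∀ {p q} → p ≤ q → ¬ (q < p)
≤⇒≯ p≤q q<p = <-irrefl refl (<-≤-trans q<p p≤q)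

∣p-q∣≤r⇒p≤q+r : ∀ {p q r} → ∣ p - q ∣ ≤ r → p ≤ q + r
∣p-q∣≤r⇒p≤q+r {p} {q} {r} h =
  subst (_≤ q + r) (p+[q-p]≡q q p) (+-monoʳ-≤ q (≤-trans (p≤∣p∣ (p - q)) h))

p<q⇒0<q-p : ∀ {p q} → p < q → 0ℚ < q - p
p<q⇒0<q-p {p} {q} p<q = subst (_< q - p) (+-inverseʳ p) (+-monoˡ-< (- p) p<q)

q<r-p⇒p+q<r : ∀ {p q r} → q < r - p → p + q < r
q<r-p⇒p+q<r {p} {q} {r} h = subst (p + q <_) (p+[q-p]≡q p r) (+-monoʳ-< p h)

p+q<r⇒p<r-q : ∀ {p q r} → p + q < r → p < r - q
p+q<r⇒p<r-q {p} {q} {r} h = subst (_< r - q) (p+q-q≡p p q) (+-monoˡ-< (- q) h)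

+-cancelʳ-≤ : ∀ r {p q} → p + r ≤ q + r → p ≤ q
+-cancelʳ-≤ r {p} {q} h = subst₂ _≤_ (p+q-q≡p p r) (p+q-q≡p q r) (+-monoˡ-≤ (- r) h)

+-cancelʳ-< : ∀ r {p q} → p + r < q + r → p < q
+-cancelʳ-< r {p} {q} h = subst₂ _<_ (p+q-q≡p p r) (p+q-q≡p q r) (+-monoˡ-< (- r) h)

infix 8 _/suc_

_/suc_ : ℕ → ℕ → ℚ
k /suc m = + k / suc m

toℚᵘ-/suc : ∀ k m → toℚᵘ (k /suc m) ℚᵘ.≃ mkℚᵘ (+ k) m
toℚᵘ-/suc k m = toℚᵘ-fromℚᵘ (mkℚᵘ (+ k) m)

/suc-cong : ∀ a m b n → a ℕ.* suc n ≡ b ℕ.* suc m → a /suc m ≡ b /suc n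
/suc-cong a m b n eq =
  fromℚᵘ-cong {mkℚᵘ (+ a) m} {mkℚᵘ (+ b) n} (ℚᵘ.*≡* (begin
  + a ℤ.* + suc n   ≡⟨ ℤ.pos-* a (suc n) ⟨
  + (a ℕ.* suc n)   ≡⟨ cong +_ eq ⟩
  + (b ℕ.* suc m)   ≡⟨ ℤ.pos-* b (suc m) ⟩
  + b ℤ.* + suc m   ∎))
  where open ≡-Reasoning

/suc-< : ∀ a m b n → a ℕ.* suc n ℕ.< b ℕ.* suc m → a /suc m < b /suc n
/suc-< a m b n lt =
  toℚᵘ-cancel-< (ℚᵘ.<-respˡ-≃ (ℚᵘ.≃-sym (toℚᵘ-/suc a m))
    (ℚᵘ.<-respʳ-≃ (ℚᵘ.≃-sym (toℚᵘ-/suc b n))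
      (ℚᵘ.*<* (subst₂ ℤ._<_ (ℤ.pos-* a (suc n)) (ℤ.pos-* b (suc m)) (ℤ.+<+ lt)))))

/suc-mono-< : ∀ m a b → a ℕ.< b → a /suc m < b /suc m
/suc-mono-< m a b a<b = /suc-< a m b m (ℕ.*-monoˡ-< (suc m) a<b)

/suc-mono-≤ : ∀ m a b → a ℕ.≤ b → a /suc m ≤ b /suc m
/suc-mono-≤ m a b a≤b with ℕ.m≤n⇒m<n∨m≡n a≤b
... | inj₁ a<b  = <⇒≤ (/suc-mono-< m a b a<b)
... | inj₂ refl = ≤-refl

/suc-+ : ∀ a b m → a /suc m + b /suc m ≡ (a ℕ.+ b) /suc m
/suc-+ a b m = toℚᵘ-injective (begin-equality
  toℚᵘ (a /suc m + b /suc m)            ≃⟨ toℚᵘ-homo-+ (a /suc m) (b /suc m) ⟩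
  toℚᵘ (a /suc m) ℚᵘ.+ toℚᵘ (b /suc m)  ≃⟨ ℚᵘ.+-cong (toℚᵘ-/suc a m) (toℚᵘ-/suc b m) ⟩
  mkℚᵘ (+ a) m ℚᵘ.+ mkℚᵘ (+ b) m        ≃⟨ ℚᵘ.*≡* (same-denominator (+ a) (+ b) (+ suc m)) ⟩
  mkℚᵘ (+ (a ℕ.+ b)) m                  ≃⟨ toℚᵘ-/suc (a ℕ.+ b) m ⟨
  toℚᵘ ((a ℕ.+ b) /suc m)               ∎)
  where
  open ℚᵘ.≤-Reasoning
  same-denominator : ∀ a b s → (a ℤ.* s ℤ.+ b ℤ.* s) ℤ.* s ≡ (a ℤ.+ b) ℤ.* (s ℤ.* s)
  same-denominator = ℤ.solve-∀

+-/suc-+ : ∀ p j k m → p + j /suc m + k /suc m ≡ p + (j ℕ.+ k) /suc m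
+-/suc-+ p j k m = trans (+-assoc p (j /suc m) (k /suc m)) (cong (_+_ p) (/suc-+ j k m))

/suc-halve : ∀ n → 1 /suc (suc (2 ℕ.* n)) + 1 /suc (suc (2 ℕ.* n)) ≡ 1 /suc n
/suc-halve n =
  trans (/suc-+ 1 1 (suc (2 ℕ.* n))) (/suc-cong 2 (suc (2 ℕ.* n)) 1 n (cross n))
  where
  cross : ∀ n → 2 ℕ.* suc n ≡ 1 ℕ.* suc (suc (2 ℕ.* n))
  cross = ℕ.solve-∀

0≤/suc : ∀ m k → 0ℚ ≤ k /suc m
0≤/suc m k = subst (_≤ k /suc m) (0/n≡0 (suc m)) (/suc-mono-≤ m 0 k ℕ.z≤n)

0</suc : ∀ m k → 0ℚ < suc k /suc m
0</suc m k = subst (_< suc k /suc m) (0/n≡0 (suc m)) (/suc-mono-< m 0 (suc k) (ℕ.s≤s ℕ.z≤n))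

p≤p+/suc : ∀ p m k → p ≤ p + k /suc m
p≤p+/suc p m k = subst (_≤ p + k /suc m) (+-identityʳ p) (+-monoʳ-≤ p (0≤/suc m k))

archimedean-0 : ∀ c {q} → 0ℚ < q → ∃[ m ] c /suc m < q
archimedean-0 c {q@(mkℚ (+ suc a) d-1 _)} _ =
  c ℕ.* suc d-1 , subst (c /suc (c ℕ.* suc d-1) <_) (fromℚᵘ-toℚᵘ q)
    (/suc-< c (c ℕ.* suc d-1) (suc a) d-1
      (ℕ.<-≤-trans (ℕ.n<1+n (c ℕ.* suc d-1)) (ℕ.m≤n*m (suc (c ℕ.* suc d-1)) (suc a))))
archimedean-0 c {mkℚ (+ zero) _ _}      (*<* (ℤ.+<+ ()))
archimedean-0 c {mkℚ ℤ.-[1+ _ ] _ _} (*<* ())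

archimedean : ∀ c {p q} → p < q → ∃[ m ] p + c /suc m < q
archimedean c {p} {q} p<q =
  let m , c/m<q-p = archimedean-0 c (p<q⇒0<q-p p<q)
  in m , q<r-p⇒p+q<r {p} {c /suc m} {q} c/m<q-p

≤+/suc⇒≤ : ∀ {p q} c → (∀ m → p ≤ q + c /suc m) → p ≤ q
≤+/suc⇒≤ {p} {q} c h with p ≤? q
... | yes p≤q = p≤q
... | no  p≰q =
  let m , q+c/m<p = archimedean c (≰⇒> p≰q) in contradiction q+c/m<p (≤⇒≯ (h m))

-- For a regular sequence x these are Bishop's x ≤ a and b ≤ x, with the
-- sharper error 1/(n+1) in place of 2/(n+1).
record AtMost (x : Seq) (a : ℚ) : Set where
  constructor atMost
  field upper : ∀ n → x n ≤ a + 1 /suc n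

record AtLeast (x : Seq) (b : ℚ) : Set where
  constructor atLeast
  field lower : ∀ n → b ≤ x n + 1 /suc n

open AtMost public
open AtLeast public

module _ {x : Seq} (x-reg : IsRegular x) where
  open ≤-Reasoning

  regular⇒≤ : ∀ m n → x m ≤ x n + (1 /suc m + 1 /suc n)
  regular⇒≤ m n = ∣p-q∣≤r⇒p≤q+r (x-reg m n)

  ≤+/suc⇒atMost : ∀ {a} c → (∀ m → x m ≤ a + c /suc m) → AtMost x a
  ≤+/suc⇒atMost {a} c h = atMost λ n → ≤+/suc⇒≤ (c ℕ.+ 1) λ m → begin
    x n                                  ≤⟨ regular⇒≤ n m ⟩
    x m + (1 /suc n + 1 /suc m)          ≤⟨ +-monoˡ-≤ _ (h m) ⟩
    a + c /suc m + (1 /suc n + 1 /suc m) ≡⟨ interchange a (c /suc m) (1 /suc n) (1 /suc m) ⟩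
    a + 1 /suc n + (c /suc m + 1 /suc m) ≡⟨ cong (_+_ (a + 1 /suc n)) (/suc-+ c 1 m) ⟩
    a + 1 /suc n + (c ℕ.+ 1) /suc m      ∎

  atMost-fromApprox : ∀ {a} k → x k + 1 /suc k ≤ a → AtMost x a
  atMost-fromApprox {a} k h = atMost λ n → begin
    x n                           ≤⟨ regular⇒≤ n k ⟩
    x k + (1 /suc n + 1 /suc k)   ≡⟨ x∙yz≈xz∙y (x k) (1 /suc n) (1 /suc k) ⟩
    x k + 1 /suc k + 1 /suc n     ≤⟨ +-monoˡ-≤ (1 /suc n) h ⟩
    a + 1 /suc n                  ∎

  atLeast-fromApprox : ∀ {b} k → b + 1 /suc k ≤ x k → AtLeast x b
  atLeast-fromApprox {b} k h = atLeast λ n → +-cancelʳ-≤ (1 /suc k) (begin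
    b + 1 /suc k                  ≤⟨ h ⟩
    x k                           ≤⟨ regular⇒≤ k n ⟩
    x n + (1 /suc k + 1 /suc n)   ≡⟨ x∙yz≈xz∙y (x n) (1 /suc k) (1 /suc n) ⟩
    x n + 1 /suc n + 1 /suc k     ∎)

  ≤ˢ-atMost-trans : ∀ {y a} → x ≤ˢ y → AtMost y a → AtMost x a
  ≤ˢ-atMost-trans {y} {a} x≤y y≤a = ≤+/suc⇒atMost 3 λ m → begin
    x m                       ≤⟨ x≤y m ⟩
    y m + 2 /suc m            ≤⟨ +-monoˡ-≤ (2 /suc m) (upper y≤a m) ⟩
    a + 1 /suc m + 2 /suc m   ≡⟨ +-/suc-+ a 1 2 m ⟩
    a + 3 /suc m              ∎

  <ˢconst⇒atMost : ∀ {q} → x <ˢ (λ _ → q) → AtMost x q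
  <ˢconst⇒atMost {q} (k , h) = atMost-fromApprox k (begin
    x k + 1 /suc k  ≤⟨ +-monoʳ-≤ (x k) (/suc-mono-≤ k 1 2 (ℕ.s≤s ℕ.z≤n)) ⟩
    x k + 2 /suc k  <⟨ q<r-p⇒p+q<r h ⟩
    q               ∎)

<ˢ⇒separated : ∀ {x y} → IsRegular x → IsRegular y → x <ˢ y →
               Σ ℚ λ a → Σ ℚ λ b → a < b × AtMost x a × AtLeast y b
<ˢ⇒separated {x} {y} x-reg y-reg (k , h) =
  x k + 1 /suc k , y k - 1 /suc k ,
  p+q<r⇒p<r-q (subst (_< y k) (sym (+-/suc-+ (x k) 1 1 k)) (q<r-p⇒p+q<r h)) ,
  atMost-fromApprox x-reg k ≤-refl ,
  atLeast-fromApprox y-reg k (≤-reflexive (p-q+q≡p (y k) (1 /suc k)))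

module _ {x y : Seq} where
  open ≤-Reasoning

  separated⇒<ˢ : ∀ {a b} → AtMost x a → AtLeast y b → a < b → x <ˢ y
  separated⇒<ˢ {a} {b} x≤a b≤y a<b =
    let m , a+4/m<b = archimedean 4 a<b
    in m , p+q<r⇒p<r-q (subst (_< y m) (+-comm (x m) (2 /suc m))
      (+-cancelʳ-< (1 /suc m) (begin-strict
        x m + 2 /suc m + 1 /suc m           ≤⟨ +-monoˡ-≤ _ (+-monoˡ-≤ _ (upper x≤a m)) ⟩
        a + 1 /suc m + 2 /suc m + 1 /suc m  ≡⟨ cong (_+ 1 /suc m) (+-/suc-+ a 1 2 m) ⟩
        a + 3 /suc m + 1 /suc m             ≡⟨ +-/suc-+ a 3 1 m ⟩
        a + 4 /suc m                        <⟨ a+4/m<b ⟩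
        b                                   ≤⟨ lower b≤y m ⟩
        y m + 1 /suc m                      ∎)))

  atMost-+ˢ : ∀ {a b} → AtMost x a → AtMost y b → AtMost (x +ˢ y) (a + b)
  atMost-+ˢ {a} {b} x≤a y≤b = atMost λ n →
    let K = suc (2 ℕ.* n) in begin
    x K + y K                          ≤⟨ +-mono-≤ (upper x≤a K) (upper y≤b K) ⟩
    a + 1 /suc K + (b + 1 /suc K)      ≡⟨ interchange a (1 /suc K) b (1 /suc K) ⟩
    a + b + (1 /suc K + 1 /suc K)      ≡⟨ cong (_+_ (a + b)) (/suc-halve n) ⟩
    a + b + 1 /suc n                   ∎

module _ {x : Seq} where
  open ≤-Reasoning

  atMost-mono : ∀ {a a′} → AtMost x a → a ≤ a′ → AtMost x a′
  atMost-mono x≤a a≤a′ = atMost λ n → ≤-trans (upper x≤a n) (+-monoˡ-≤ _ a≤a′)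

  atLeast-atMost⇒≤ : ∀ {a b} → AtLeast x b → AtMost x a → b ≤ a
  atLeast-atMost⇒≤ {a} {b} b≤x x≤a = ≤+/suc⇒≤ 2 λ n → begin
    b                        ≤⟨ lower b≤x n ⟩
    x n + 1 /suc n           ≤⟨ +-monoˡ-≤ (1 /suc n) (upper x≤a n) ⟩
    a + 1 /suc n + 1 /suc n  ≡⟨ +-/suc-+ a 1 1 n ⟩
    a + 2 /suc n             ∎

≈ˢ⇒≤ˢ : ∀ {x y} → x ≈ˢ y → x ≤ˢ y
≈ˢ⇒≤ˢ x≈y n = ∣p-q∣≤r⇒p≤q+r (x≈y n)

atMost-0ˢ : AtMost 0ˢ 0ℚ
atMost-0ˢ = atMost λ n → p≤p+/suc 0ℚ n 1

const : ℚ → ℝ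
const q = mkℝ (λ _ → q) λ m n → begin
  ∣ q - q ∣                ≡⟨ cong ∣_∣ (+-inverseʳ q) ⟩
  0ℚ                       ≤⟨ 0≤/suc m 1 ⟩
  1 /suc m                 ≤⟨ p≤p+/suc (1 /suc m) n 1 ⟩
  1 /suc m + 1 /suc n      ∎
  where open ≤-Reasoning

atLeast-const : ∀ q → AtLeast (seq (const q)) q
atLeast-const q = atLeast λ n → p≤p+/suc q n 1

const-positive : ∀ {q} → 0ℚ < q → Positive (const q)
const-positive {q} q>0 = separated⇒<ˢ atMost-0ˢ (atLeast-const q) q>0

guard : ∀ {P A : Set} → Dec P → A → Maybe A
guard (yes _) a = just a
guard (no _)  _ = nothing

guard-just : ∀ {P A : Set} (p? : Dec P) {a b : A} → guard p? a ≡ just b → P × a ≡ b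
guard-just (yes p) refl = p , refl

guard-yes : ∀ {P A : Set} (p? : Dec P) {a : A} → P → guard p? a ≡ just a
guard-yes (yes _) _ = refl
guard-yes (no ¬p) p = contradiction p ¬p

module _ (M : MetricSpace) where
  open MetricSpace M

  dist : Carrier → Carrier → Seq
  dist y z = seq (d y z)

  dist-sym : ∀ {y z q} → AtMost (dist z y) q → AtMost (dist y z) q
  dist-sym {y} {z} = ≤ˢ-atMost-trans {dist y z} (reg (d y z)) (≈ˢ⇒≤ˢ (d-sym y z))

  dist-self : ∀ y → AtMost (dist y y) 0ℚ
  dist-self y =
    ≤ˢ-atMost-trans {dist y y} (reg (d y y)) (≈ˢ⇒≤ˢ {y = 0ˢ} (≡⇒d-zero y)) atMost-0ˢ

  dist-triangle : ∀ {x y z p q} →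
                  AtMost (dist x y) p → AtMost (dist y z) q → AtMost (dist x z) (p + q)
  dist-triangle {x} {y} {z} xy≤p yz≤q =
    ≤ˢ-atMost-trans {dist x z} (reg (d x z)) (d-tri x y z) (atMost-+ˢ xy≤p yz≤q)

  ball⇒atMost : ∀ {y z q} → Ball M y (const q) z → AtMost (dist y z) q
  ball⇒atMost {y} {z} = <ˢconst⇒atMost {dist y z} (reg (d y z))

  atMost⇒ball : ∀ {y z p q} → AtMost (dist y z) p → p < q → Ball M y (const q) z
  atMost⇒ball {q = q} yz≤p p<q = separated⇒<ˢ yz≤p (atLeast-const q) p<q

  rationalBall : Carrier → (q : ℚ) → 0ℚ < q → PosBall M
  rationalBall y q q>0 = ball y (const q) (const-positive q>0)

  ⋃ : (ℕ → Maybe (PosBall M)) → Subset Carrier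
  ⋃ f z = ∃[ n ] Σ (PosBall M) λ B →
            f n ≡ just B × Ball M (PosBall.centre B) (PosBall.radius B) z

  ⋃-open : ∀ f → IsOpen M (⋃ f)
  ⋃-open f = f , λ _ → id , id

  open⇒neighbourhood : ∀ {U x} → IsOpen M U → U x →
    Σ ℚ λ ε → 0ℚ < ε × (∀ {z q} → q < ε → AtMost (dist x z) q → U z)
  open⇒neighbourhood {U} {x} (f , U⇔⋃f) x∈U =
    let n , ball c r r>0 , fn≡B , x∈B = proj₁ (U⇔⋃f x) x∈U
        a , b , a<b , cx≤a , b≤r =
          <ˢ⇒separated {dist c x} {seq r} (reg (d c x)) (reg r) x∈B
    in b - a , p<q⇒0<q-p a<b , λ q<b-a xz≤q →
         proj₂ (U⇔⋃f _) (n , ball c r r>0 , fn≡B ,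
           separated⇒<ˢ (dist-triangle cx≤a xz≤q) b≤r (q<r-p⇒p+q<r q<b-a))

  module Separation
    (s : ℕ → Carrier) (s-dense : ∀ y (r : ℝ) → Positive r → ∃[ n ] Ball M y r (s n))
    (x : Carrier) (N : ℕ)
    where

    δ : ℕ → ℚ
    δ k = k /suc N

    B₂ : Carrier → PosBall M
    B₂ y = rationalBall y (δ 2) (0</suc N 1)

    S T : Subset Carrier
    S = ⋃ λ _ → just (B₂ x)
    T = ⋃ λ n → guard (δ 6 ≤? dist x (s n) N) (B₂ (s n))

    S-near : ∀ {z} → S z → AtMost (dist x z) (δ 2)
    S-near (_ , _ , refl , z∈B) = ball⇒atMost z∈B

    x∈S : S x
    x∈S = 0 , B₂ x , refl , atMost⇒ball (dist-self x) (0</suc N 1)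

    far⇒apart : ∀ {n z} → δ 6 ≤ dist x (s n) N →
                AtMost (dist x z) (δ 2) → AtMost (dist (s n) z) (δ 2) → ⊥
    far⇒apart {n} far xz≤δ₂ sₙz≤δ₂ =
      ≤⇒≯ (atLeast-atMost⇒≤ δ₅≤xsₙ xsₙ≤δ₄) (/suc-mono-< N 4 5 (ℕ.n<1+n 4))
      where
      xsₙ≤δ₄ : AtMost (dist x (s n)) (δ 4)
      xsₙ≤δ₄ = atMost-mono (dist-triangle xz≤δ₂ (dist-sym sₙz≤δ₂))
                           (≤-reflexive (/suc-+ 2 2 N))
      δ₅≤xsₙ : AtLeast (dist x (s n)) (δ 5)
      δ₅≤xsₙ = atLeast-fromApprox (reg (d x (s n))) N
                 (subst (_≤ dist x (s n) N) (sym (/suc-+ 5 1 N)) far)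

    S∩T≡∅ : ∀ z → S z → T z → ⊥
    S∩T≡∅ z z∈S (n , B , gₙ≡B , z∈B) =
      apart (guard-just (δ 6 ≤? dist x (s n) N) gₙ≡B) z∈B
      where
      apart : δ 6 ≤ dist x (s n) N × B₂ (s n) ≡ B →
              Ball M (PosBall.centre B) (PosBall.radius B) z → ⊥
      apart (far , refl) z∈B₂ = far⇒apart far (S-near z∈S) (ball⇒atMost z∈B₂)

    far⇒T : ∀ {z} n → δ 6 ≤ dist x (s n) N → AtMost (dist (s n) z) (δ 1) → T z
    far⇒T n far sₙz≤δ₁ =
      n , B₂ (s n) , guard-yes (δ 6 ≤? dist x (s n) N) far ,
      atMost⇒ball sₙz≤δ₁ (/suc-mono-< N 1 2 (ℕ.n<1+n 1))

    close⇒near : ∀ {z} n → ¬ δ 6 ≤ dist x (s n) N → AtMost (dist (s n) z) (δ 1) →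
                 AtMost (dist x z) (δ 8)
    close⇒near n ¬far sₙz≤δ₁ =
      atMost-mono (dist-triangle xsₙ≤δ₇ sₙz≤δ₁) (≤-reflexive (/suc-+ 7 1 N))
      where
      xsₙ≤δ₇ : AtMost (dist x (s n)) (δ 7)
      xsₙ≤δ₇ = atMost-fromApprox (reg (d x (s n))) N
                 (subst (dist x (s n) N + δ 1 ≤_) (/suc-+ 6 1 N)
                        (+-monoˡ-≤ (δ 1) (<⇒≤ (≰⇒> ¬far))))

    T∪near : ∀ z → T z ⊎ AtMost (dist x z) (δ 8)
    T∪near z =
      let n , sₙ∈B = s-dense z (const (δ 1)) (const-positive (0</suc N 0))
          sₙz≤δ₁ = dist-sym (ball⇒atMost sₙ∈B)
      in Sum.map (λ far → far⇒T n far sₙz≤δ₁) (λ ¬far → close⇒near n ¬far sₙz≤δ₁)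
                 (toSum (δ 6 ≤? dist x (s n) N))

proposition3p15 : (M : MetricSpace) → Separable M → PointwiseRegular M
proposition3p15 M (s , s-dense) x U U-open x∈U =
  let ε , ε>0 , nbhd = open⇒neighbourhood M U-open x∈U
      N , δ₈<ε = archimedean-0 8 ε>0
      open Separation M s s-dense x N
  in S , T , ⋃-open M _ , ⋃-open M _ , S∩T≡∅ , x∈S ,
     (λ _ z∈S → nbhd (≤-<-trans (/suc-mono-≤ N 2 8 (ℕ.m≤m+n 2 6)) δ₈<ε)
                     (S-near z∈S)) ,
     (λ z → Sum.map₂ (nbhd δ₈<ε) (T∪near z))
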